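{- Let $M$ be a locally bounded commutative ordered monoid with distinguished element $0$, with $0\leq1$, and let the multiplication on $M$ be continuous, preadmissible, and satisfy condition (*) relative to $\overline{M}$. Equip the completion $\overline{M}$ with the multiplication $xy=\sup P_{x,y}$. Then $\overline{M}$ is a commutative ordered monoid (with identity $1$ and distinguished element $0$).
   Context: All reasoning is constructive (no law of excluded middle). An ordered set is a set $X$ with a binary relation $<$ satisfying, for all $x,y,z$: asymmetry ($x<y$ implies not $y<x$), cotransitivity ($x<y$ implies $x<z$ or $z<y$), and negative antisymmetry (not $x<y$ and not $y<x$ imply $x=y$). Write $x\leq y$ for "not $y<x$", $x>y$ for $y<x$. A subset $S$ of $X$ is almost dense if $x<y$ in $X$ implies $x\leq s<s'\leq y$ for some $s,s'\in S$; bicofinal if each $x\in X$ satisfies $s\leq x\leq s'$ for some $s,s'\in S$; upper order located if $x<y$ implies either $x<s$ for some $s\in S$ or $u<y$ for some upper bound $u$ of $S$; supable if nonempty, bounded above and upper order located. $X$ is complete if every supable subset has a supremum in $X$. A completion of $X$ is a complete ordered set $Y$ with an order embedding ($x<x'$ iff $f(x)<f(x')$) $f:X\to Y$ whose image is almost dense and bicofinal in $Y$; it exists and is unique up to isomorphism, and $\overline{M}$ denotes the completion of $M$, with $M$ identified with its image. A set is finitely enumerable if it is empty or the image of $\{1,\dots,n\}$. A commutative ordered monoid with distinguished element $0$ is an ordered set $M$ with a distinguished element $0$ and a commutative monoid multiplication (identity $1$) such that $0<x,0<y$ imply $0<xy$; it is locally bounded if every finitely enumerable subset has a minimum and a maximum.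 The multiplication on $M$ is preadmissible if $0x=0=x0$, $x<y$ and $z>0$ imply $xz<yz$, and $x<y$ and $z<0$ imply $xz>yz$. Continuity refers to the order topology on $M$ (generated by open intervals $\{z:a<z<b\}$) and the product topology on $M\times M$. Condition (*): for all $x,y\in\overline{M}$, if $c<d$ in $M$ then there are $a,b,a',b'\in M$ with $a\leq x\leq b$, $a'\leq y\leq b'$ and either $c<\min\{aa',ab',ba',bb'\}$ or $\max\{aa',ab',ba',bb'\}<d$ (min, max in $M$). For $x,y\in\overline{M}$, $P_{x,y}=\{\min\{aa',ab',ba',bb'\}: a,b,a',b'\in M,\ a\leq x\leq b,\ a'\leq y\leq b'\}$; under these hypotheses $P_{x,y}$ is supable, so $xy:=\sup P_{x,y}$ exists in $\overline{M}$. -}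

module Defs where

open import Data.Nat using (ℕ; suc)
open import Data.Fin using (Fin)
open import Data.Product using (Σ; Σ-syntax; ∃; _×_; _,_)
open import Data.Sum using (_⊎_)
open import Data.List using (List)
open import Data.List.Relation.Unary.All using (All)
open import Relation.Nullary using (¬_)
open import Relation.Binary.PropositionalEquality using (_≡_)
open import Algebra.Structures using (IsCommutativeMonoid)

record IsOrderedSet {X : Set} (_<_ : X → X → Set) : Set where
  field
    asym       : ∀ {x y} → x < y → ¬ (y < x)
    cotrans    : ∀ {x y} (z : X) → x < y → (x < z) ⊎ (z < y)
    negAntisym : ∀ {x y} → ¬ (x < y) → ¬ (y < x) → x ≡ y

Le : {X : Set} → (X → X → Set) → X → X → Set
Le _<_ x y = ¬ (y < x)

module _ {X : Set} (_<_ : X → X → Set) where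

  IsUpperBound : (X → Set) → X → Set
  IsUpperBound S u = ∀ s → S s → Le _<_ s u

  IsSup : (X → Set) → X → Set
  IsSup S σ = IsUpperBound S σ × (∀ y → y < σ → Σ[ s ∈ X ] (S s × y < s))

  UpperOrderLocated : (X → Set) → Set
  UpperOrderLocated S =
    ∀ x y → x < y →
      (Σ[ s ∈ X ] (S s × x < s)) ⊎ (Σ[ u ∈ X ] (IsUpperBound S u × u < y))

  Supable : (X → Set) → Set
  Supable S = (Σ[ s ∈ X ] S s) × (Σ[ u ∈ X ] IsUpperBound S u) × UpperOrderLocated S

  IsComplete : Set₁
  IsComplete = ∀ (S : X → Set) → Supable S → Σ[ σ ∈ X ] IsSup S σ

record IsCompletion {M Y : Set} (_<M_ : M → M → Set) (_<Y_ : Y → Y → Set)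
                    (f : M → Y) : Set₁ where
  field
    orderedY   : IsOrderedSet _<Y_
    complete   : IsComplete _<Y_
    embed      : ∀ x x' → x <M x' → f x <Y f x'
    reflect    : ∀ x x' → f x <Y f x' → x <M x'
    almostDense : ∀ x y → x <Y y →
      Σ[ s ∈ M ] Σ[ s' ∈ M ] (Le _<Y_ x (f s) × f s <Y f s' × Le _<Y_ (f s') y)
    bicofinal  : ∀ x → Σ[ s ∈ M ] Σ[ s' ∈ M ] (Le _<Y_ (f s) x × Le _<Y_ x (f s'))

record IsCommOrderedMonoid {X : Set} (_<_ : X → X → Set) (_·_ : X → X → X)
                           (𝟘 𝟙 : X) : Set where
  field
    ordered     : IsOrderedSet _<_
    commMonoid  : IsCommutativeMonoid _≡_ _·_ 𝟙
    pos         : ∀ {x y} → 𝟘 < x → 𝟘 < y → 𝟘 < (x · y)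

module _ {X : Set} (_<_ : X → X → Set) (_·_ : X → X → X) (𝟘 : X) where

  LocallyBounded : Set
  LocallyBounded = ∀ (n : ℕ) (g : Fin (suc n) → X) →
    (Σ[ i ∈ Fin (suc n) ] (∀ j → Le _<_ (g i) (g j))) ×
    (Σ[ i ∈ Fin (suc n) ] (∀ j → Le _<_ (g j) (g i)))

  Preadmissible : Set
  Preadmissible =
    (∀ x → (𝟘 · x ≡ 𝟘) × (x · 𝟘 ≡ 𝟘)) ×
    (∀ x y z → x < y → 𝟘 < z → (x · z) < (y · z)) ×
    (∀ x y z → x < y → z < 𝟘 → (y · z) < (x · z))

  InInterval : X × X → X → Set
  InInterval (a , b) z = (a < z) × (z < b)

  -- a basic open set of the order topology: a finite intersection of open
  -- intervals (the empty intersection being X)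
  InBasic : List (X × X) → X → Set
  InBasic L z = All (λ I → InInterval I z) L

  -- continuity of _·_ : X × X → X (order topology, product topology):
  -- the preimage of every subbasic open interval is open, i.e. every point
  -- of it has a basic product neighbourhood U × V inside it.
  ContinuousMul : Set
  ContinuousMul = ∀ x y a b → a < (x · y) → (x · y) < b →
    Σ[ Lx ∈ List (X × X) ] Σ[ Ly ∈ List (X × X) ]
      (InBasic Lx x × InBasic Ly y ×
       (∀ u v → InBasic Lx u → InBasic Ly v → (a < (u · v)) × ((u · v) < b)))

module _ {X : Set} (_<_ : X → X → Set) where

  In4 : X → X → X → X → X → Set
  In4 m p q r s = (m ≡ p) ⊎ (m ≡ q) ⊎ (m ≡ r) ⊎ (m ≡ s)

  IsMin4 : X → X → X → X → X → Set
  IsMin4 m p q r s = In4 m p q r s ×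
    (Le _<_ m p × Le _<_ m q × Le _<_ m r × Le _<_ m s)

  IsMax4 : X → X → X → X → X → Set
  IsMax4 m p q r s = In4 m p q r s ×
    (Le _<_ p m × Le _<_ q m × Le _<_ r m × Le _<_ s m)

module _ {M Y : Set} (_<M_ : M → M → Set) (_·_ : M → M → M)
         (_<Y_ : Y → Y → Set) (f : M → Y) where

  Between : M → Y → M → Set
  Between a x b = Le _<Y_ (f a) x × Le _<Y_ x (f b)

  ConditionStar : Set
  ConditionStar = ∀ (x y : Y) (c d : M) → c <M d →
    Σ[ a ∈ M ] Σ[ b ∈ M ] Σ[ a' ∈ M ] Σ[ b' ∈ M ]
      (Between a x b × Between a' y b' ×
        ((Σ[ m ∈ M ] (IsMin4 _<M_ m (a · a') (a · b') (b · a') (b · b') × c <M m))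
         ⊎
         (Σ[ m ∈ M ] (IsMax4 _<M_ m (a · a') (a · b') (b · a') (b · b') × m <M d))))

  -- P_{x,y} as a subset of Y (M identified with its image under f)
  P : Y → Y → Y → Set
  P x y z = Σ[ a ∈ M ] Σ[ b ∈ M ] Σ[ a' ∈ M ] Σ[ b' ∈ M ]
      (Between a x b × Between a' y b' ×
        (Σ[ m ∈ M ] (IsMin4 _<M_ m (a · a') (a · b') (b · a') (b · b') × z ≡ f m)))

-- Call a rectangle [a , b] × [a′ , b′] in M around (x , y) a box; then
-- f c < x ⊙ y exactly when some box has all four corner products above c,
-- and by preadmissibility every product u · v with (u , v) in a box lies
-- between two of its corners. This yields commutativity, the unit and
-- positivity of ⊙ directly. For associativity, suppose
-- x ⊙ (y ⊙ z) < (x ⊙ y) ⊙ z: condition (*) and the supremum property give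
-- e < d in M, a box for (x , y ⊙ z) with corners below d and a box for
-- (x ⊙ y , z) with corners above e. Continuity of the product at the bounds
-- of these boxes refines them into boxes for (x , y) and (y , z), and a
-- point (u , v , w) common to all of them yields a value
-- (u · v) · w = u · (v · w) strictly between e and d; running the argument
-- again with this value in place of both e and d is absurd. All
-- conclusions are negations (x ≤ y means ¬ y < x), so case distinctions
-- may be made under double negation.

module Submission where

open import Defs
open import Data.Fin using (Fin; zero; suc)
open import Data.Empty using (⊥; ⊥-elim)
open import Data.Product using (Σ-syntax; _×_; _,_; proj₁; proj₂; uncurry)
open import Data.Sum using (_⊎_; inj₁; inj₂; [_,_]′)
open import Data.List using (List; []; _∷_)
open import Data.List.Relation.Unary.All as All using (All; []; _∷_)
open import Function using (id; _∘_)
open import Level using (0ℓ)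
open import Relation.Nullary using (¬_; yes; no)
open import Relation.Nullary.Negation using (¬¬-Monad)
open import Relation.Nullary.Decidable using (¬¬-excluded-middle)
open import Relation.Binary.Definitions using (Tri; tri<; tri≈; tri>; Maximum; Minimum)
open import Relation.Binary.PropositionalEquality
  using (_≡_; refl; sym; trans; cong; cong₂; subst; subst₂; isEquivalence)
open import Algebra.Structures using (IsCommutativeMonoid)
open import Algebra.Structures.Biased using (isCommutativeMonoidʳ)
open import Effect.Monad using (RawMonad)

open RawMonad (¬¬-Monad {0ℓ}) using (pure; _>>=_; _<$>_; _⊗_)

module OrderedSet {X : Set} {_<_ : X → X → Set} (ordered : IsOrderedSet _<_) where

  open IsOrderedSet ordered public

  infix 4 _≤_ _∈[_,_]

  _≤_ : X → X → Set
  _≤_ = Le _<_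

  <-irrefl : ∀ {x} → ¬ x < x
  <-irrefl x<x = asym x<x x<x

  ≤-refl : ∀ {x} → x ≤ x
  ≤-refl = <-irrefl

  ≤-reflexive : ∀ {x y} → x ≡ y → x ≤ y
  ≤-reflexive refl = ≤-refl

  <⇒≤ : ∀ {x y} → x < y → x ≤ y
  <⇒≤ = asym

  ≤-antisym : ∀ {x y} → x ≤ y → y ≤ x → x ≡ y
  ≤-antisym x≤y y≤x = negAntisym y≤x x≤y

  <-≤-trans : ∀ {x y z} → x < y → y ≤ z → x < z
  <-≤-trans {z = z} x<y y≤z = [ id , ⊥-elim ∘ y≤z ]′ (cotrans z x<y)

  ≤-<-trans : ∀ {x y z} → x ≤ y → y < z → x < z
  ≤-<-trans {x = x} x≤y y<z = [ ⊥-elim ∘ x≤y , id ]′ (cotrans x y<z)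

  <-trans : ∀ {x y z} → x < y → y < z → x < z
  <-trans x<y y<z = <-≤-trans x<y (<⇒≤ y<z)

  ≤-trans : ∀ {x y z} → x ≤ y → y ≤ z → x ≤ z
  ≤-trans {y = y} x≤y y≤z z<x = [ y≤z , x≤y ]′ (cotrans y z<x)

  ¬¬-trichotomous : ∀ x y → ¬ ¬ Tri (x < y) (x ≡ y) (y < x)
  ¬¬-trichotomous x y = do
    no x≮y ← ¬¬-excluded-middle
      where yes x<y → pure (tri< x<y (λ { refl → <-irrefl x<y }) (asym x<y))
    no y≮x ← ¬¬-excluded-middle
      where yes y<x → pure (tri> (asym y<x) (λ { refl → <-irrefl y<x }) y<x)
    pure (tri≈ x≮y (negAntisym x≮y y≮x) y≮x)

  _∈[_,_] : X → X → X → Set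
  u ∈[ a , b ] = a ≤ u × u ≤ b

  InIntervals : List (X × X) → X → Set
  InIntervals L z = All (λ I → proj₁ I < z × z < proj₂ I) L

  HoldsLeftOf : X → (X → Set) → Set
  HoldsLeftOf α Q =
    (Σ[ ℓ ∈ X ] (ℓ < α × (∀ t → ℓ < t → t < α → ¬ ¬ Q t))) ⊎ Minimum _≤_ α

  HoldsRightOf : X → (X → Set) → Set
  HoldsRightOf α Q =
    (Σ[ ρ ∈ X ] (α < ρ × (∀ t → α < t → t < ρ → ¬ ¬ Q t))) ⊎ Maximum _≤_ α

  module _ {α : X} {Q : X → Set} where

    holdsLeftOf-below : (∀ t → t < α → ¬ ¬ Q t) → ¬ ¬ HoldsLeftOf α Q
    holdsLeftOf-below below = do
      yes (t , t<α) ← ¬¬-excluded-middle {A = Σ[ t ∈ X ] t < α}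
        where no ∄t → pure (inj₂ (λ t t<α → ∄t (t , t<α)))
      pure (inj₁ (t , t<α , λ s _ s<α → below s s<α))

    holdsRightOf-above : (∀ t → α < t → ¬ ¬ Q t) → ¬ ¬ HoldsRightOf α Q
    holdsRightOf-above above = do
      yes (t , α<t) ← ¬¬-excluded-middle {A = Σ[ t ∈ X ] α < t}
        where no ∄t → pure (inj₂ (λ t α<t → ∄t (t , α<t)))
      pure (inj₁ (t , α<t , λ s α<s _ → above s α<s))

    holdsLeftOf-map : {R : X → Set} → (∀ {t} → Q t → R t) → HoldsLeftOf α Q → HoldsLeftOf α R
    holdsLeftOf-map g (inj₁ (ℓ , ℓ<α , H)) = inj₁ (ℓ , ℓ<α , λ t ℓ<t t<α → g <$> H t ℓ<t t<α)
    holdsLeftOf-map g (inj₂ least) = inj₂ least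

    holdsRightOf-map : {R : X → Set} → (∀ {t} → Q t → R t) → HoldsRightOf α Q → HoldsRightOf α R
    holdsRightOf-map g (inj₁ (ρ , α<ρ , H)) = inj₁ (ρ , α<ρ , λ t α<t t<ρ → g <$> H t α<t t<ρ)
    holdsRightOf-map g (inj₂ greatest) = inj₂ greatest

    holdsLeftOf-× : {R : X → Set} → HoldsLeftOf α Q → HoldsLeftOf α R →
                    ¬ ¬ HoldsLeftOf α (λ t → Q t × R t)
    holdsLeftOf-× (inj₂ least) _ = pure (inj₂ least)
    holdsLeftOf-× (inj₁ _) (inj₂ least) = pure (inj₂ least)
    holdsLeftOf-× (inj₁ (ℓ , ℓ<α , HQ)) (inj₁ (ℓ′ , ℓ′<α , HR)) = do
      no ℓ≮ℓ′ ← ¬¬-excluded-middle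
        where yes ℓ<ℓ′ → pure (inj₁ (ℓ′ , ℓ′<α , λ t ℓ′<t t<α →
                HQ t (<-trans ℓ<ℓ′ ℓ′<t) t<α ⊗ HR t ℓ′<t t<α))
      pure (inj₁ (ℓ , ℓ<α , λ t ℓ<t t<α → HQ t ℓ<t t<α ⊗ HR t (≤-<-trans ℓ≮ℓ′ ℓ<t) t<α))

    holdsRightOf-× : {R : X → Set} → HoldsRightOf α Q → HoldsRightOf α R →
                     ¬ ¬ HoldsRightOf α (λ t → Q t × R t)
    holdsRightOf-× (inj₂ greatest) _ = pure (inj₂ greatest)
    holdsRightOf-× (inj₁ _) (inj₂ greatest) = pure (inj₂ greatest)
    holdsRightOf-× (inj₁ (ρ , α<ρ , HQ)) (inj₁ (ρ′ , α<ρ′ , HR)) = do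
      no ρ≮ρ′ ← ¬¬-excluded-middle
        where yes ρ<ρ′ → pure (inj₁ (ρ , α<ρ , λ t α<t t<ρ →
                HQ t α<t t<ρ ⊗ HR t α<t (<-trans t<ρ ρ<ρ′)))
      pure (inj₁ (ρ′ , α<ρ′ , λ t α<t t<ρ′ → HQ t α<t (<-≤-trans t<ρ′ ρ≮ρ′) ⊗ HR t α<t t<ρ′))

  holdsLeftOf-intervals : ∀ L {α} → InIntervals L α → ¬ ¬ HoldsLeftOf α (InIntervals L)
  holdsLeftOf-intervals [] [] = holdsLeftOf-below {Q = InIntervals []} (λ _ _ → pure [])
  holdsLeftOf-intervals ((a , b) ∷ L) ((a<α , α<b) ∷ α∈L) = do
    H ← holdsLeftOf-intervals L α∈L
    H′ ← holdsLeftOf-× (inj₁ (a , a<α , λ t a<t t<α → pure (a<t , <-trans t<α α<b))) H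
    pure (holdsLeftOf-map (uncurry _∷_) H′)

  holdsRightOf-intervals : ∀ L {α} → InIntervals L α → ¬ ¬ HoldsRightOf α (InIntervals L)
  holdsRightOf-intervals [] [] = holdsRightOf-above {Q = InIntervals []} (λ _ _ → pure [])
  holdsRightOf-intervals ((a , b) ∷ L) ((a<α , α<b) ∷ α∈L) = do
    H ← holdsRightOf-intervals L α∈L
    H′ ← holdsRightOf-× (inj₁ (b , α<b , λ t α<t t<b → pure (<-trans a<α α<t , t<b))) H
    pure (holdsRightOf-map (uncurry _∷_) H′)

  minimum-intervals : ∀ L {γ} → Minimum _≤_ γ → InIntervals L γ → ∀ z → InIntervals L z
  minimum-intervals [] least [] z = []
  minimum-intervals (_ ∷ _) least ((a<γ , _) ∷ _) z = ⊥-elim (least _ a<γ)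

module PreadmissibleMonoid {M : Set} {_<_ : M → M → Set} {_·_ : M → M → M} {𝟘 𝟙 : M}
    (isMonoid : IsCommOrderedMonoid _<_ _·_ 𝟘 𝟙) (preadmissible : Preadmissible _<_ _·_ 𝟘) where

  open IsCommOrderedMonoid isMonoid public using (ordered; commMonoid; pos)
  open IsCommutativeMonoid commMonoid public using (assoc; comm; identityˡ; identityʳ)
  open OrderedSet ordered public

  ·-zeroˡ : ∀ x → 𝟘 · x ≡ 𝟘
  ·-zeroˡ x = proj₁ (proj₁ preadmissible x)

  ·-zeroʳ : ∀ x → x · 𝟘 ≡ 𝟘
  ·-zeroʳ x = proj₂ (proj₁ preadmissible x)

  ·𝟘-unique : ∀ x y → x · 𝟘 ≡ y · 𝟘
  ·𝟘-unique x y = trans (·-zeroʳ x) (sym (·-zeroʳ y))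

  𝟘≡𝟙⇒≡𝟘 : 𝟘 ≡ 𝟙 → ∀ x → x ≡ 𝟘
  𝟘≡𝟙⇒≡𝟘 𝟘≡𝟙 x = trans (sym (identityʳ x)) (trans (cong (x ·_) (sym 𝟘≡𝟙)) (·-zeroʳ x))

  ·-monoˡ-< : ∀ {x y z} → 𝟘 < z → x < y → (x · z) < (y · z)
  ·-monoˡ-< 0<z x<y = proj₁ (proj₂ preadmissible) _ _ _ x<y 0<z

  ·-antimonoˡ-< : ∀ {x y z} → z < 𝟘 → x < y → (y · z) < (x · z)
  ·-antimonoˡ-< z<0 x<y = proj₂ (proj₂ preadmissible) _ _ _ x<y z<0

  ·-monoˡ-≤ : ∀ {x y z} → 𝟘 < z → x ≤ y → (x · z) ≤ (y · z)
  ·-monoˡ-≤ {x} {y} 0<z x≤y yz<xz = ¬¬-trichotomous x y λ where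
    (tri< x<y _ _) → asym (·-monoˡ-< 0<z x<y) yz<xz
    (tri≈ _ refl _) → <-irrefl yz<xz
    (tri> _ _ y<x) → x≤y y<x

  ·-antimonoˡ-≤ : ∀ {x y z} → z < 𝟘 → x ≤ y → (y · z) ≤ (x · z)
  ·-antimonoˡ-≤ {x} {y} z<0 x≤y xz<yz = ¬¬-trichotomous x y λ where
    (tri< x<y _ _) → asym (·-antimonoˡ-< z<0 x<y) xz<yz
    (tri≈ _ refl _) → <-irrefl xz<yz
    (tri> _ _ y<x) → x≤y y<x

  -- u ↦ u · v is monotone or antitone according to the sign of v.
  ¬¬-endpoint-≤ : ∀ {a u b} v → u ∈[ a , b ] → ¬ ¬ ((a · v) ≤ (u · v) ⊎ (b · v) ≤ (u · v))
  ¬¬-endpoint-≤ {a} {u} v (a≤u , u≤b) = ¬¬-trichotomous v 𝟘 >>= λ where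
    (tri< v<0 _ _) → pure (inj₂ (·-antimonoˡ-≤ v<0 u≤b))
    (tri≈ _ refl _) → pure (inj₁ (≤-reflexive (·𝟘-unique a u)))
    (tri> _ _ 0<v) → pure (inj₁ (·-monoˡ-≤ 0<v a≤u))

  ¬¬-≤-endpoint : ∀ {a u b} v → u ∈[ a , b ] → ¬ ¬ ((u · v) ≤ (a · v) ⊎ (u · v) ≤ (b · v))
  ¬¬-≤-endpoint {a} {u} v (a≤u , u≤b) = ¬¬-trichotomous v 𝟘 >>= λ where
    (tri< v<0 _ _) → pure (inj₁ (·-antimonoˡ-≤ v<0 a≤u))
    (tri≈ _ refl _) → pure (inj₁ (≤-reflexive (·𝟘-unique u a)))
    (tri> _ _ 0<v) → pure (inj₂ (·-monoˡ-≤ 0<v u≤b))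

  <·-endpointsˡ : ∀ {c a b u} v → c < (a · v) → c < (b · v) → u ∈[ a , b ] → ¬ ¬ c < (u · v)
  <·-endpointsˡ v c<av c<bv u∈ =
    [ <-≤-trans c<av , <-≤-trans c<bv ]′ <$> ¬¬-endpoint-≤ v u∈

  ·<-endpointsˡ : ∀ {d a b u} v → (a · v) < d → (b · v) < d → u ∈[ a , b ] → ¬ ¬ (u · v) < d
  ·<-endpointsˡ v av<d bv<d u∈ =
    [ (λ uv≤av → ≤-<-trans uv≤av av<d) , (λ uv≤bv → ≤-<-trans uv≤bv bv<d) ]′
      <$> ¬¬-≤-endpoint v u∈

  <·-endpointsʳ : ∀ {c a b v} u → c < (u · a) → c < (u · b) → v ∈[ a , b ] → ¬ ¬ c < (u · v)
  <·-endpointsʳ {a = a} {b} {v} u c<ua c<ub v∈ =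
    subst (_ <_) (comm v u)
      <$> <·-endpointsˡ u (subst (_ <_) (comm u a) c<ua) (subst (_ <_) (comm u b) c<ub) v∈

  ·<-endpointsʳ : ∀ {d a b v} u → (u · a) < d → (u · b) < d → v ∈[ a , b ] → ¬ ¬ (u · v) < d
  ·<-endpointsʳ {a = a} {b} {v} u ua<d ub<d v∈ =
    subst (_< _) (comm v u)
      <$> ·<-endpointsˡ u (subst (_< _) (comm u a) ua<d) (subst (_< _) (comm u b) ub<d) v∈

  Corners : (M → Set) → M → M → M → M → Set
  Corners Q a b a′ b′ = Q (a · a′) × Q (a · b′) × Q (b · a′) × Q (b · b′)

  corners-map : ∀ {Q R : M → Set} {a b a′ b′} → (∀ {κ} → Q κ → R κ) →
                Corners Q a b a′ b′ → Corners R a b a′ b′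
  corners-map g (q₁ , q₂ , q₃ , q₄) = g q₁ , g q₂ , g q₃ , g q₄

  corners-∈ : ∀ {Q : M → Set} {κ a b a′ b′} → Corners Q a b a′ b′ →
              In4 _<_ κ (a · a′) (a · b′) (b · a′) (b · b′) → Q κ
  corners-∈ (q₁ , _ , _ , _) (inj₁ refl) = q₁
  corners-∈ (_ , q₂ , _ , _) (inj₂ (inj₁ refl)) = q₂
  corners-∈ (_ , _ , q₃ , _) (inj₂ (inj₂ (inj₁ refl))) = q₃
  corners-∈ (_ , _ , _ , q₄) (inj₂ (inj₂ (inj₂ refl))) = q₄

  <·-corners : ∀ {c a b a′ b′ u v} → Corners (c <_) a b a′ b′ →
               u ∈[ a , b ] → v ∈[ a′ , b′ ] → ¬ ¬ c < (u · v)
  <·-corners (c<aa′ , c<ab′ , c<ba′ , c<bb′) u∈ v∈ = do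
    c<av ← <·-endpointsʳ _ c<aa′ c<ab′ v∈
    c<bv ← <·-endpointsʳ _ c<ba′ c<bb′ v∈
    <·-endpointsˡ _ c<av c<bv u∈

  ·<-corners : ∀ {d a b a′ b′ u v} → Corners (_< d) a b a′ b′ →
               u ∈[ a , b ] → v ∈[ a′ , b′ ] → ¬ ¬ (u · v) < d
  ·<-corners (aa′<d , ab′<d , ba′<d , bb′<d) u∈ v∈ = do
    av<d ← ·<-endpointsʳ _ aa′<d ab′<d v∈
    bv<d ← ·<-endpointsʳ _ ba′<d bb′<d v∈
    ·<-endpointsˡ _ av<d bv<d u∈

  maximum≡𝟙 : 𝟘 ≤ 𝟙 → ∀ {m} → Maximum _≤_ m → m ≡ 𝟙
  maximum≡𝟙 0≤1 {m} top = ≤-antisym m≤1 (top 𝟙)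
    where
    m≤1 : m ≤ 𝟙
    m≤1 1<m = top (m · m) (subst (_< (m · m)) (identityˡ m) (·-monoˡ-< (≤-<-trans 0≤1 1<m) 1<m))

  module _ (cont : ContinuousMul _<_ _·_ 𝟘) where

    continuity-holdsLeftOf : ∀ {c d α γ} → c < (α · γ) → (α · γ) < d →
      ¬ ¬ HoldsLeftOf α (λ t → c < (t · γ) × (t · γ) < d)
    continuity-holdsLeftOf {α = α} {γ} c<αγ αγ<d with cont α γ _ _ c<αγ αγ<d
    ... | Lα , _ , α∈Lα , γ∈Lγ , nbhd =
      holdsLeftOf-map (λ {t} t∈Lα → nbhd t γ t∈Lα γ∈Lγ) <$> holdsLeftOf-intervals Lα α∈Lα

    continuity-holdsRightOf : ∀ {c d α γ} → c < (α · γ) → (α · γ) < d →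
      ¬ ¬ HoldsRightOf α (λ t → c < (t · γ) × (t · γ) < d)
    continuity-holdsRightOf {α = α} {γ} c<αγ αγ<d with cont α γ _ _ c<αγ αγ<d
    ... | Lα , _ , α∈Lα , γ∈Lγ , nbhd =
      holdsRightOf-map (λ {t} t∈Lα → nbhd t γ t∈Lα γ∈Lγ) <$> holdsRightOf-intervals Lα α∈Lα

    -- Every basic neighbourhood of a least element γ contains 𝟙, and 𝟙 · t = t.
    minimum-·-gap : ∀ {γ t} → Minimum _≤_ γ → γ < (γ · t) → (γ · t) < t → ⊥
    minimum-·-gap {γ} {t} least γ<γt γt<t with cont γ t γ t γ<γt γt<t
    ... | Lγ , _ , γ∈Lγ , t∈Lt , nbhd =
      let (_ , 1t<t) = nbhd 𝟙 t (minimum-intervals Lγ least γ∈Lγ 𝟙) t∈Lt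
      in <-irrefl (subst (_< t) (identityˡ t) 1t<t)

    -- In each of the following four lemmas continuity applies unless α · γ
    -- is an extreme element of M; those degenerate cases force γ (or α) to
    -- be 𝟘 or 𝟙, or to be extreme itself.
    <·-holdsLeftOf : ∀ {c α γ} → c < (α · γ) → ¬ ¬ HoldsLeftOf α (λ t → c < (t · γ))
    <·-holdsLeftOf {c} {α} {γ} c<αγ = do
      no αγ≮ ← ¬¬-excluded-middle {A = Σ[ d ∈ M ] (α · γ) < d}
        where yes (_ , αγ<d) → holdsLeftOf-map proj₁ <$> continuity-holdsLeftOf c<αγ αγ<d
      let top : Maximum _≤_ (α · γ)
          top d αγ<d = αγ≮ (d , αγ<d)
      tri< γ<0 _ _ ← ¬¬-trichotomous γ 𝟘
        where
        (tri≈ _ refl _) → holdsLeftOf-below λ t _ → pure (subst (c <_) (·𝟘-unique α t) c<αγ)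
        (tri> _ _ 0<γ) → do
          tri> _ _ 0<α ← ¬¬-trichotomous α 𝟘
            where
            (tri< α<0 _ _) → ⊥-elim (top 𝟘 (subst ((α · γ) <_) (·-zeroˡ γ) (·-monoˡ-< 0<γ α<0)))
            (tri≈ _ refl _) → ⊥-elim (top γ (subst (_< γ) (sym (·-zeroˡ γ)) 0<γ))
          let γ≡1 : γ ≡ 𝟙
              γ≡1 = ≤-antisym
                (λ 1<γ → top (γ · (α · γ))
                   (subst (_< (γ · (α · γ))) (identityˡ _) (·-monoˡ-< (pos 0<α 0<γ) 1<γ)))
                (λ γ<1 → top α (subst₂ _<_ (comm γ α) (identityˡ α) (·-monoˡ-< 0<α γ<1)))
              ·γ-id : ∀ t → t ≡ (t · γ)
              ·γ-id t = trans (sym (identityʳ t)) (cong (t ·_) (sym γ≡1))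
          pure (inj₁ (c , subst (c <_) (sym (·γ-id α)) c<αγ ,
                      λ t c<t _ → pure (subst (c <_) (·γ-id t) c<t)))
      holdsLeftOf-below λ t t<α → pure (<-trans c<αγ (·-antimonoˡ-< γ<0 t<α))

    <·-holdsRightOf : 𝟘 ≤ 𝟙 → ∀ {c α γ} → c < (α · γ) → ¬ ¬ HoldsRightOf α (λ t → c < (t · γ))
    <·-holdsRightOf 0≤1 {c} {α} {γ} c<αγ = do
      no αγ≮ ← ¬¬-excluded-middle {A = Σ[ d ∈ M ] (α · γ) < d}
        where yes (_ , αγ<d) → holdsRightOf-map proj₁ <$> continuity-holdsRightOf c<αγ αγ<d
      let top : Maximum _≤_ (α · γ)
          top d αγ<d = αγ≮ (d , αγ<d)
      tri< γ<0 _ _ ← ¬¬-trichotomous γ 𝟘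
        where
        (tri≈ _ refl _) → holdsRightOf-above λ t _ → pure (subst (c <_) (·𝟘-unique α t) c<αγ)
        (tri> _ _ 0<γ) → holdsRightOf-above λ t α<t → pure (<-trans c<αγ (·-monoˡ-< 0<γ α<t))
      tri< α<0 _ _ ← ¬¬-trichotomous α 𝟘
        where
        (tri> _ _ 0<α) → ⊥-elim (top 𝟘 (subst ((α · γ) <_) (·-zeroˡ γ) (·-antimonoˡ-< γ<0 0<α)))
        (tri≈ _ refl _) → ⊥-elim (<-irrefl (subst (_< 𝟘)
          (𝟘≡𝟙⇒≡𝟘 (trans (sym (·-zeroˡ γ)) (maximum≡𝟙 0≤1 top)) γ) γ<0))
      -- Here α · γ = 𝟙, so t ↦ t · γ inverts multiplication by α < 𝟘.
      let αγ≡1 : (α · γ) ≡ 𝟙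
          αγ≡1 = maximum≡𝟙 0≤1 top
          c<1 : c < 𝟙
          c<1 = subst (c <_) αγ≡1 c<αγ
          cancel : ∀ t → ((t · γ) · α) ≡ t
          cancel t = trans (assoc t γ α) (trans (cong (t ·_) (trans (comm γ α) αγ≡1)) (identityʳ t))
          c<tγ : ∀ t → t < (c · α) → ¬ ¬ c < (t · γ)
          c<tγ t t<cα = ¬¬-trichotomous c (t · γ) >>= λ where
            (tri< c<tγ _ _) → pure c<tγ
            (tri≈ _ c≡tγ _) →
              ⊥-elim (<-irrefl (subst (t <_) (trans (cong (_· α) c≡tγ) (cancel t)) t<cα))
            (tri> _ _ tγ<c) →
              ⊥-elim (asym t<cα (subst ((c · α) <_) (cancel t) (·-antimonoˡ-< α<0 tγ<c)))
      pure (inj₁ (c · α , subst (_< (c · α)) (identityˡ α) (·-antimonoˡ-< α<0 c<1) ,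
                  λ t _ t<cα → c<tγ t t<cα))

    ·<-holdsLeftOf : 𝟘 ≤ 𝟙 → ∀ {d α γ} → (α · γ) < d → ¬ ¬ HoldsLeftOf α (λ t → (t · γ) < d)
    ·<-holdsLeftOf 0≤1 {d} {α} {γ} αγ<d = do
      no ≮αγ ← ¬¬-excluded-middle {A = Σ[ c ∈ M ] c < (α · γ)}
        where yes (_ , c<αγ) → holdsLeftOf-map proj₂ <$> continuity-holdsLeftOf c<αγ αγ<d
      let bottom : Minimum _≤_ (α · γ)
          bottom c c<αγ = ≮αγ (c , c<αγ)
      tri< γ<0 _ _ ← ¬¬-trichotomous γ 𝟘
        where
        (tri≈ _ refl _) → holdsLeftOf-below λ t _ → pure (subst (_< d) (·𝟘-unique α t) αγ<d)
        (tri> _ _ 0<γ) → pure (inj₂ λ t t<α → bottom (t · γ) (·-monoˡ-< 0<γ t<α))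
      -- Here α = 𝟙 and γ is least, which continuity at (γ , t) rules out for 𝟘 < t < 𝟙.
      let α≡1 : α ≡ 𝟙
          α≡1 = maximum≡𝟙 0≤1 λ t α<t → bottom (t · γ) (·-antimonoˡ-< γ<0 α<t)
          γ-least : Minimum _≤_ γ
          γ-least c c<γ = bottom c (subst (c <_) (sym (trans (cong (_· γ) α≡1) (identityˡ γ))) c<γ)
      tri< 0<1 _ _ ← ¬¬-trichotomous 𝟘 𝟙
        where
        (tri≈ _ 0≡1 _) → ⊥-elim (<-irrefl (subst (_< 𝟘) (𝟘≡𝟙⇒≡𝟘 0≡1 γ) γ<0))
        (tri> _ _ 1<0) → ⊥-elim (0≤1 1<0)
      pure (inj₁ (𝟘 , subst (𝟘 <_) (sym α≡1) 0<1 , λ t 0<t t<α → ⊥-elim (minimum-·-gap γ-least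
        (subst₂ _<_ (identityˡ γ) (comm t γ) (·-antimonoˡ-< γ<0 (subst (t <_) α≡1 t<α)))
        (<-trans (subst ((γ · t) <_) (·-zeroˡ t) (·-monoˡ-< 0<t γ<0)) 0<t))))

    ·<-holdsRightOf : ∀ {d α γ} → (α · γ) < d →
      ¬ ¬ (HoldsRightOf α (λ t → (t · γ) < d) ⊎ (α ≡ 𝟘 × Minimum _≤_ 𝟘))
    ·<-holdsRightOf {d} {α} {γ} αγ<d = do
      no ≮αγ ← ¬¬-excluded-middle {A = Σ[ c ∈ M ] c < (α · γ)}
        where yes (_ , c<αγ) → inj₁ ∘ holdsRightOf-map proj₂ <$> continuity-holdsRightOf c<αγ αγ<d
      let bottom : Minimum _≤_ (α · γ)
          bottom c c<αγ = ≮αγ (c , c<αγ)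
      tri> _ _ 0<γ ← ¬¬-trichotomous γ 𝟘
        where
        (tri≈ _ refl _) → inj₁ <$> holdsRightOf-above λ t _ → pure (subst (_< d) (·𝟘-unique α t) αγ<d)
        (tri< γ<0 _ _) →
          inj₁ <$> holdsRightOf-above λ t α<t → pure (<-trans (·-antimonoˡ-< γ<0 α<t) αγ<d)
      let α-least : Minimum _≤_ α
          α-least t t<α = bottom (t · γ) (·-monoˡ-< 0<γ t<α)
      tri< α<0 _ _ ← ¬¬-trichotomous α 𝟘
        where
        (tri≈ _ α≡0 _) → pure (inj₂ (α≡0 , subst (Minimum _≤_) α≡0 α-least))
        (tri> _ _ 0<α) → ⊥-elim (α-least 𝟘 0<α)
      let γ≡1 : γ ≡ 𝟙
          γ≡1 = ≤-antisym
            (λ 1<γ → α-least (α · γ) (subst₂ _<_ (comm γ α) (identityˡ α) (·-antimonoˡ-< α<0 1<γ)))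
            (λ γ<1 → bottom α (subst₂ _<_ (identityˡ α) (comm γ α) (·-antimonoˡ-< α<0 γ<1)))
          ·γ-id : ∀ t → (t · γ) ≡ t
          ·γ-id t = trans (cong (t ·_) γ≡1) (identityʳ t)
      pure (inj₁ (inj₁ (d , subst (_< d) (·γ-id α) αγ<d ,
                        λ t _ t<d → pure (subst (_< d) (sym (·γ-id t)) t<d))))

module CompletionProduct
    {M Y : Set} {_<_ : M → M → Set} {_·_ : M → M → M} {𝟘 𝟙 : M}
    (isMonoid : IsCommOrderedMonoid _<_ _·_ 𝟘 𝟙)
    (locallyBounded : LocallyBounded _<_ _·_ 𝟘)
    (0≤1 : Le _<_ 𝟘 𝟙)
    (cont : ContinuousMul _<_ _·_ 𝟘)
    (preadmissible : Preadmissible _<_ _·_ 𝟘)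
    {_<Y_ : Y → Y → Set} {f : M → Y}
    (completion : IsCompletion _<_ _<Y_ f)
    (star : ConditionStar _<_ _·_ _<Y_ f)
    {_⊙_ : Y → Y → Y}
    (⊙-sup : ∀ x y → IsSup _<Y_ (P _<_ _·_ _<Y_ f x y) (x ⊙ y)) where

  open PreadmissibleMonoid isMonoid preadmissible
  open IsCompletion completion using (orderedY; embed; reflect; almostDense; bicofinal)
  module Y = OrderedSet orderedY

  infix 4 _∈ᶠ[_,_]

  _∈ᶠ[_,_] : Y → M → M → Set
  x ∈ᶠ[ a , b ] = Between _<_ _·_ _<Y_ f a x b

  ≤-reflect : ∀ {a b} → f a Y.≤ f b → a ≤ b
  ≤-reflect fa≤fb b<a = fa≤fb (embed _ _ b<a)

  ∈ᶠ⇒∈ : ∀ {u a b} → f u ∈ᶠ[ a , b ] → u ∈[ a , b ]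
  ∈ᶠ⇒∈ (fa≤fu , fu≤fb) = ≤-reflect fa≤fu , ≤-reflect fu≤fb

  ∈ᶠ⇒≤ : ∀ {x a b} → x ∈ᶠ[ a , b ] → a ≤ b
  ∈ᶠ⇒≤ (fa≤x , x≤fb) = ≤-reflect (Y.≤-trans fa≤x x≤fb)

  record Box (x y : Y) : Set where
    constructor box
    field
      lo₁ hi₁ lo₂ hi₂ : M
      ∈₁ : x ∈ᶠ[ lo₁ , hi₁ ]
      ∈₂ : y ∈ᶠ[ lo₂ , hi₂ ]

  open Box

  InBox : ∀ {x y} → Box x y → M → M → Set
  InBox B u v = u ∈[ lo₁ B , hi₁ B ] × v ∈[ lo₂ B , hi₂ B ]

  BoxCorners : ∀ {x y} → (M → Set) → Box x y → Set
  BoxCorners Q B = Corners Q (lo₁ B) (hi₁ B) (lo₂ B) (hi₂ B)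

  someBox : ∀ x y → Box x y
  someBox x y with bicofinal x | bicofinal y
  ... | a , b , x∈ | a′ , b′ , y∈ = box a b a′ b′ x∈ y∈

  swapBox : ∀ {x y} → Box x y → Box y x
  swapBox (box a b a′ b′ x∈ y∈) = box a′ b′ a b y∈ x∈

  swapCorners : ∀ {Q x y} (B : Box x y) → BoxCorners Q B → BoxCorners Q (swapBox B)
  swapCorners {Q} _ (q₁ , q₂ , q₃ , q₄) =
    subst Q (comm _ _) q₁ , subst Q (comm _ _) q₃ , subst Q (comm _ _) q₂ , subst Q (comm _ _) q₄

  minimum4 : ∀ p q r s → Σ[ m ∈ M ] IsMin4 _<_ m p q r s
  minimum4 p q r s =
    let (i , min) = proj₁ (locallyBounded 3 corner)
    in corner i , corner-∈ i ,
       min zero , min (suc zero) , min (suc (suc zero)) , min (suc (suc (suc zero)))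
    where
    corner : Fin 4 → M
    corner zero = p
    corner (suc zero) = q
    corner (suc (suc zero)) = r
    corner (suc (suc (suc zero))) = s

    corner-∈ : ∀ i → In4 _<_ (corner i) p q r s
    corner-∈ zero = inj₁ refl
    corner-∈ (suc zero) = inj₂ (inj₁ refl)
    corner-∈ (suc (suc zero)) = inj₂ (inj₂ (inj₁ refl))
    corner-∈ (suc (suc (suc zero))) = inj₂ (inj₂ (inj₂ refl))

  boxAbove⇒<⊙ : ∀ {x y c} (B : Box x y) → BoxCorners (c <_) B → f c <Y (x ⊙ y)
  boxAbove⇒<⊙ {x} {y} {c} (box a b a′ b′ x∈ y∈) c<corners =
    let (m , m∈ , m≤) = minimum4 (a · a′) (a · b′) (b · a′) (b · b′)
    in Y.<-≤-trans (embed _ m (corners-∈ {Q = c <_} c<corners m∈))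
                   (proj₁ (⊙-sup x y) (f m) (a , b , a′ , b′ , x∈ , y∈ , m , (m∈ , m≤) , refl))

  <⊙⇒boxAbove : ∀ {x y c} → f c <Y (x ⊙ y) → Σ[ B ∈ Box x y ] BoxCorners (c <_) B
  <⊙⇒boxAbove {x} {y} {c} fc<xy with proj₂ (⊙-sup x y) (f c) fc<xy
  ... | _ , (a , b , a′ , b′ , x∈ , y∈ , m , (_ , m≤) , refl) , fc<fm =
    box a b a′ b′ x∈ y∈ , corners-map {Q = m ≤_} (<-≤-trans (reflect _ _ fc<fm)) m≤

  ⊙<⇒boxBelow : ∀ {x y d} → (x ⊙ y) <Y f d → ¬ ¬ (Σ[ B ∈ Box x y ] BoxCorners (_< d) B)
  ⊙<⇒boxBelow {x} {y} xy<fd with almostDense _ _ xy<fd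
  ... | s , s′ , xy≤fs , fs<fs′ , fs′≤fd with star x y s s′ (reflect _ _ fs<fs′)
  ... | a , b , a′ , b′ , x∈ , y∈ , inj₁ (m , (_ , m≤) , s<m) =
    ⊥-elim (xy≤fs (boxAbove⇒<⊙ (box a b a′ b′ x∈ y∈) (corners-map {Q = m ≤_} (<-≤-trans s<m) m≤)))
  ... | a , b , a′ , b′ , x∈ , y∈ , inj₂ (m , (_ , ≤m) , m<s′) =
    pure (box a b a′ b′ x∈ y∈ ,
          corners-map {Q = _≤ m} (λ κ≤m → ≤-<-trans κ≤m (<-≤-trans m<s′ (≤-reflect fs′≤fd))) ≤m)

  holdsLeftOf⇒box : ∀ {x y a Q} → HoldsLeftOf a Q → f a Y.≤ (x ⊙ y) →
    Σ[ B ∈ Box x y ] (∀ {u v} → InBox B u v → (u · v) < a → ¬ ¬ Q (u · v))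
  holdsLeftOf⇒box (inj₂ least) _ = someBox _ _ , λ _ uv<a → ⊥-elim (least _ uv<a)
  holdsLeftOf⇒box (inj₁ (ℓ , ℓ<a , H)) fa≤xy =
    let (B , ℓ<corners) = <⊙⇒boxAbove (Y.<-≤-trans (embed _ _ ℓ<a) fa≤xy)
    in B , λ (u∈ , v∈) uv<a → <·-corners ℓ<corners u∈ v∈ >>= λ ℓ<uv → H _ ℓ<uv uv<a

  holdsRightOf⇒box : ∀ {x y b Q} → HoldsRightOf b Q → (x ⊙ y) Y.≤ f b →
    ¬ ¬ (Σ[ B ∈ Box x y ] (∀ {u v} → InBox B u v → b < (u · v) → ¬ ¬ Q (u · v)))
  holdsRightOf⇒box (inj₂ greatest) _ = pure (someBox _ _ , λ {_} {_} _ b<uv → ⊥-elim (greatest _ b<uv))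
  holdsRightOf⇒box (inj₁ (ρ , b<ρ , H)) xy≤fb = do
    (B , corners<ρ) ← ⊙<⇒boxBelow (Y.≤-<-trans xy≤fb (embed _ _ b<ρ))
    pure (B , λ {_} {_} (u∈ , v∈) b<uv → ·<-corners corners<ρ u∈ v∈ >>= λ uv<ρ → H _ b<uv uv<ρ)

  -- A box for ((x ⊙ y) , z) controls (u · v) · w only for u · v between its
  -- first bounds; continuity at those bounds extends the control to all
  -- (u , v) in two boxes for (x , y).
  refine-above : ∀ {x y z c} (B : Box (x ⊙ y) z) → BoxCorners (c <_) B →
    ¬ ¬ (Σ[ B₁ ∈ Box x y ] Σ[ B₂ ∈ Box x y ]
      (∀ {u v w} → InBox B₁ u v → InBox B₂ u v → w ∈[ lo₂ B , hi₂ B ] → ¬ ¬ c < ((u · v) · w)))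
  refine-above {c = c} (box a b a″ b″ (fa≤xy , xy≤fb) _)
               c<corners@(c<aa″ , c<ab″ , c<ba″ , c<bb″) = do
    left₁ ← <·-holdsLeftOf cont c<aa″
    left₂ ← <·-holdsLeftOf cont c<ab″
    left ← holdsLeftOf-× left₁ left₂
    right₁ ← <·-holdsRightOf cont 0≤1 c<ba″
    right₂ ← <·-holdsRightOf cont 0≤1 c<bb″
    right ← holdsRightOf-× right₁ right₂
    let (B₁ , below-a) = holdsLeftOf⇒box left fa≤xy
    (B₂ , above-b) ← holdsRightOf⇒box right xy≤fb
    pure (B₁ , B₂ , λ {u} {v} {w} ∈B₁ ∈B₂ w∈ → do
      let c<·w : ∀ {t} → c < (t · a″) × c < (t · b″) → ¬ ¬ c < (t · w)
          c<·w (c<ta″ , c<tb″) = <·-endpointsʳ _ c<ta″ c<tb″ w∈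
      no uv≮a ← ¬¬-excluded-middle {A = (u · v) < a}
        where yes uv<a → below-a ∈B₁ uv<a >>= c<·w
      no b≮uv ← ¬¬-excluded-middle {A = b < (u · v)}
        where yes b<uv → above-b ∈B₂ b<uv >>= c<·w
      <·-corners c<corners (uv≮a , b≮uv) w∈)

  -- The mirror image of refine-above, except when the upper bound of y ⊙ z
  -- is 𝟘 and 𝟘 is least, where continuity says nothing to the right of it.
  refine-below : ∀ {x y z d} (B : Box x (y ⊙ z)) → BoxCorners (_< d) B →
    ¬ ¬ ((Σ[ B₃ ∈ Box y z ] Σ[ B₄ ∈ Box y z ]
           (∀ {u v w} → u ∈[ lo₁ B , hi₁ B ] → InBox B₃ v w → InBox B₄ v w → ¬ ¬ (u · (v · w)) < d))
         ⊎ (hi₂ B ≡ 𝟘 × Minimum _≤_ 𝟘))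
  refine-below {d = d} (box p q r s _ (fr≤yz , yz≤fs))
               corners<d@(pr<d , ps<d , qr<d , qs<d) = do
    left₁ ← ·<-holdsLeftOf cont 0≤1 (subst (_< d) (comm p r) pr<d)
    left₂ ← ·<-holdsLeftOf cont 0≤1 (subst (_< d) (comm q r) qr<d)
    left ← holdsLeftOf-× left₁ left₂
    inj₁ right₁ ← ·<-holdsRightOf cont (subst (_< d) (comm p s) ps<d)
      where inj₂ s-least → pure (inj₂ s-least)
    inj₁ right₂ ← ·<-holdsRightOf cont (subst (_< d) (comm q s) qs<d)
      where inj₂ s-least → pure (inj₂ s-least)
    right ← holdsRightOf-× right₁ right₂
    let (B₃ , below-r) = holdsLeftOf⇒box left fr≤yz
    (B₄ , above-s) ← holdsRightOf⇒box right yz≤fs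
    pure (inj₁ (B₃ , B₄ , λ {u} {v} {w} u∈ ∈B₃ ∈B₄ → do
      let ·<d : ∀ {t} → (t · p) < d × (t · q) < d → ¬ ¬ (u · t) < d
          ·<d (tp<d , tq<d) =
            ·<-endpointsˡ _ (subst (_< d) (comm _ p) tp<d) (subst (_< d) (comm _ q) tq<d) u∈
      no vw≮r ← ¬¬-excluded-middle {A = (v · w) < r}
        where yes vw<r → below-r ∈B₃ vw<r >>= ·<d
      no s≮vw ← ¬¬-excluded-middle {A = s < (v · w)}
        where yes s<vw → above-s ∈B₄ s<vw >>= ·<d
      ·<-corners corners<d u∈ (vw≮r , s≮vw)))

  ¬¬-commonPoint : ∀ {x} (L : List (M × M)) → All (λ I → x ∈ᶠ[ proj₁ I , proj₂ I ]) L →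
    ¬ ¬ (Σ[ u ∈ M ] All (λ I → u ∈[ proj₁ I , proj₂ I ]) L)
  ¬¬-commonPoint {x} L x∈L = do
    (u , fu≤x , lo≤u) ← ¬¬-lowerPoint L x∈L
    pure (u , All.zipWith (λ ((_ , x≤fhi) , lo≤u) → lo≤u , ≤-reflect (Y.≤-trans fu≤x x≤fhi))
                          (x∈L , lo≤u))
    where
    ¬¬-lowerPoint : ∀ L → All (λ I → x ∈ᶠ[ proj₁ I , proj₂ I ]) L →
      ¬ ¬ (Σ[ u ∈ M ] (f u Y.≤ x × All (λ I → proj₁ I ≤ u) L))
    ¬¬-lowerPoint [] [] = let (u , _ , fu≤x , _) = bicofinal x in pure (u , fu≤x , [])
    ¬¬-lowerPoint ((a , _) ∷ L) ((fa≤x , _) ∷ x∈L) = do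
      (u , fu≤x , lo≤u) ← ¬¬-lowerPoint L x∈L
      no a≮u ← ¬¬-excluded-middle {A = a < u}
        where yes a<u → pure (u , fu≤x , <⇒≤ a<u ∷ lo≤u)
      pure (a , fa≤x , ≤-refl ∷ All.map (λ lo≤u′ → ≤-trans lo≤u′ a≮u) lo≤u)

  bracketAbove : ∀ {c x} → f c <Y x → Σ[ a ∈ M ] Σ[ b ∈ M ] (c < a × c < b × x ∈ᶠ[ a , b ])
  bracketAbove {c} {x} fc<x with almostDense _ _ fc<x | bicofinal x
  ... | _ , s , fc≤fr , fr<fs , fs≤x | _ , b , _ , x≤fb =
    let c<s = ≤-<-trans (≤-reflect fc≤fr) (reflect _ _ fr<fs)
    in s , b , c<s , <-≤-trans c<s (∈ᶠ⇒≤ (fs≤x , x≤fb)) , fs≤x , x≤fb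

  f𝟘-least : Minimum _≤_ 𝟘 → Minimum Y._≤_ (f 𝟘)
  f𝟘-least least w w<f0 =
    let (s , _ , fs≤w , _) = bicofinal w
    in least s (reflect _ _ (Y.≤-<-trans fs≤w w<f0))

  ⊙-zeroʳ : ∀ x → (x ⊙ f 𝟘) ≡ f 𝟘
  ⊙-zeroʳ x = Y.≤-antisym x𝟘≤𝟘 𝟘≤x𝟘
    where
    x𝟘≤𝟘 : (x ⊙ f 𝟘) Y.≤ f 𝟘
    x𝟘≤𝟘 f0<x0 =
      let (box a _ _ _ x∈ 0∈ , 0<corners) = <⊙⇒boxAbove f0<x0
      in <·-corners 0<corners (≤-refl , ∈ᶠ⇒≤ x∈) (∈ᶠ⇒∈ 0∈) λ 0<a0 →
           <-irrefl (subst (𝟘 <_) (·-zeroʳ a) 0<a0)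

    𝟘≤x𝟘 : f 𝟘 Y.≤ (x ⊙ f 𝟘)
    𝟘≤x𝟘 x0<f0 = ⊙<⇒boxBelow x0<f0 λ (box a _ _ _ x∈ 0∈ , corners<0) →
      ·<-corners corners<0 (≤-refl , ∈ᶠ⇒≤ x∈) (∈ᶠ⇒∈ 0∈) λ a0<0 →
        <-irrefl (subst (_< 𝟘) (·-zeroʳ a) a0<0)

  ⊙-comm-≤ : ∀ x y → (x ⊙ y) Y.≤ (y ⊙ x)
  ⊙-comm-≤ x y yx<xy with almostDense _ _ yx<xy
  ... | s , _ , yx≤fs , fs<fs′ , fs′≤xy =
    let (B , s<corners) = <⊙⇒boxAbove (Y.<-≤-trans fs<fs′ fs′≤xy)
    in yx≤fs (boxAbove⇒<⊙ (swapBox B) (swapCorners {Q = s <_} B s<corners))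

  ⊙-comm : ∀ x y → (x ⊙ y) ≡ (y ⊙ x)
  ⊙-comm x y = Y.≤-antisym (⊙-comm-≤ x y) (⊙-comm-≤ y x)

  ⊙-identityʳ : ∀ x → (x ⊙ f 𝟙) ≡ x
  ⊙-identityʳ x = Y.≤-antisym x𝟙≤x x≤x𝟙
    where
    x𝟙≤x : (x ⊙ f 𝟙) Y.≤ x
    x𝟙≤x x<x1 with almostDense _ _ x<x1
    ... | s , _ , x≤fs , fs<fs′ , fs′≤x1 =
      let (box a _ _ _ x∈ 1∈ , s<corners) = <⊙⇒boxAbove (Y.<-≤-trans fs<fs′ fs′≤x1)
      in <·-corners s<corners (≤-refl , ∈ᶠ⇒≤ x∈) (∈ᶠ⇒∈ 1∈) λ s<a1 →
           ≤-reflect (Y.≤-trans (proj₁ x∈) x≤fs) (subst (s <_) (identityʳ a) s<a1)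

    x≤x𝟙 : x Y.≤ (x ⊙ f 𝟙)
    x≤x𝟙 x1<x with almostDense _ _ x1<x
    ... | s , _ , x1≤fs , fs<fs′ , fs′≤x =
      let (a , b , s<a , s<b , x∈) = bracketAbove (Y.<-≤-trans fs<fs′ fs′≤x)
          s<·1 = λ {t} → subst (s <_) (sym (identityʳ t))
      in x1≤fs (boxAbove⇒<⊙ (box a b 𝟙 𝟙 x∈ (Y.≤-refl , Y.≤-refl))
                            (s<·1 s<a , s<·1 s<a , s<·1 s<b , s<·1 s<b))

  ⊙-pos : ∀ {x y} → f 𝟘 <Y x → f 𝟘 <Y y → f 𝟘 <Y (x ⊙ y)
  ⊙-pos 0<x 0<y =
    let (a , b , 0<a , 0<b , x∈) = bracketAbove 0<x
        (a′ , b′ , 0<a′ , 0<b′ , y∈) = bracketAbove 0<y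
    in boxAbove⇒<⊙ (box a b a′ b′ x∈ y∈) (pos 0<a 0<a′ , pos 0<a 0<b′ , pos 0<b 0<a′ , pos 0<b 0<b′)

  ¬¬-zeroFactor : Minimum _≤_ 𝟘 → ∀ {y z} → (y ⊙ z) Y.≤ f 𝟘 → ¬ ¬ (y ≡ f 𝟘 ⊎ z ≡ f 𝟘)
  ¬¬-zeroFactor least {y} {z} yz≤0 = do
    yes 0<y ← ¬¬-excluded-middle {A = f 𝟘 <Y y}
      where no 0≮y → pure (inj₁ (Y.≤-antisym 0≮y (f𝟘-least least y)))
    yes 0<z ← ¬¬-excluded-middle {A = f 𝟘 <Y z}
      where no 0≮z → pure (inj₂ (Y.≤-antisym 0≮z (f𝟘-least least z)))
    ⊥-elim (yz≤0 (⊙-pos 0<y 0<z))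

  zeroFactor⇒≡𝟘 : ∀ {x y z} → y ≡ f 𝟘 ⊎ z ≡ f 𝟘 → ((x ⊙ y) ⊙ z) ≡ f 𝟘
  zeroFactor⇒≡𝟘 {x} {z = z} (inj₁ refl) =
    trans (cong (_⊙ z) (⊙-zeroʳ x)) (trans (⊙-comm (f 𝟘) z) (⊙-zeroʳ z))
  zeroFactor⇒≡𝟘 (inj₂ refl) = ⊙-zeroʳ _

  -- The witness is (u · v) · w = u · (v · w) for a point common to all
  -- refined boxes.
  ¬¬-between : ∀ {x y z c d} → (x ⊙ (y ⊙ z)) <Y ((x ⊙ y) ⊙ z) →
    Σ[ B ∈ Box (x ⊙ y) z ] BoxCorners (c <_) B →
    Σ[ B ∈ Box x (y ⊙ z) ] BoxCorners (_< d) B →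
    ¬ ¬ (Σ[ t ∈ M ] (c < t × t < d))
  ¬¬-between {x} {y} {z} {c} L<R (Bₒ , c<Bₒ) (Bᵢ , Bᵢ<d) = do
    (B₁ , B₂ , c<uv·w) ← refine-above Bₒ c<Bₒ
    inj₁ (B₃ , B₄ , u·vw<d) ← refine-below Bᵢ Bᵢ<d
      where inj₂ (hi≡𝟘 , 𝟘-least) → do
              factor ← ¬¬-zeroFactor 𝟘-least (subst (λ h → (y ⊙ z) Y.≤ f h) hi≡𝟘 (proj₂ (∈₂ Bᵢ)))
              ⊥-elim (f𝟘-least 𝟘-least _ (subst ((x ⊙ (y ⊙ z)) <Y_) (zeroFactor⇒≡𝟘 factor) L<R))
    (u , u∈₁ ∷ u∈₂ ∷ u∈ᵢ ∷ []) ←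
      ¬¬-commonPoint (_ ∷ _ ∷ _ ∷ []) (∈₁ B₁ ∷ ∈₁ B₂ ∷ ∈₁ Bᵢ ∷ [])
    (v , v∈₁ ∷ v∈₂ ∷ v∈₃ ∷ v∈₄ ∷ []) ←
      ¬¬-commonPoint (_ ∷ _ ∷ _ ∷ _ ∷ []) (∈₂ B₁ ∷ ∈₂ B₂ ∷ ∈₁ B₃ ∷ ∈₁ B₄ ∷ [])
    (w , w∈ₒ ∷ w∈₃ ∷ w∈₄ ∷ []) ←
      ¬¬-commonPoint (_ ∷ _ ∷ _ ∷ []) (∈₂ Bₒ ∷ ∈₂ B₃ ∷ ∈₂ B₄ ∷ [])
    c<uvw ← c<uv·w (u∈₁ , v∈₁) (u∈₂ , v∈₂) w∈ₒ
    uvw<d ← u·vw<d u∈ᵢ (v∈₃ , w∈₃) (v∈₄ , w∈₄)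
    pure (u · (v · w) , subst (c <_) (assoc u v w) c<uvw , uvw<d)

  ⊙-assoc-≤ : ∀ x y z → ((x ⊙ y) ⊙ z) Y.≤ (x ⊙ (y ⊙ z))
  ⊙-assoc-≤ x y z L<R with almostDense _ _ L<R
  ... | c , d , L≤fc , fc<fd , fd≤R with star x (y ⊙ z) c d (reflect _ _ fc<fd)
  ... | a , b , a′ , b′ , x∈ , yz∈ , inj₁ (m , (_ , m≤) , c<m) =
    L≤fc (boxAbove⇒<⊙ (box a b a′ b′ x∈ yz∈) (corners-map {Q = m ≤_} (<-≤-trans c<m) m≤))
  ... | a , b , a′ , b′ , x∈ , yz∈ , inj₂ (e , (_ , ≤e) , e<d) =
    -- the value t found between e and d separates the two boxes once more
    ¬¬-between L<R (R-above e<d) (Bᵢ-below e<d) λ (t , e<t , t<d) →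
    ¬¬-between L<R (R-above t<d) (Bᵢ-below e<t) λ (_ , t<s , s<t) → asym t<s s<t
    where
    R-above : ∀ {t} → t < d → Σ[ B ∈ Box (x ⊙ y) z ] BoxCorners (t <_) B
    R-above t<d = <⊙⇒boxAbove (Y.<-≤-trans (embed _ _ t<d) fd≤R)

    Bᵢ-below : ∀ {t} → e < t → Σ[ B ∈ Box x (y ⊙ z) ] BoxCorners (_< t) B
    Bᵢ-below e<t = box a b a′ b′ x∈ yz∈ , corners-map {Q = _≤ e} (λ κ≤e → ≤-<-trans κ≤e e<t) ≤e

  ⊙-assoc : ∀ x y z → ((x ⊙ y) ⊙ z) ≡ (x ⊙ (y ⊙ z))
  ⊙-assoc x y z =
    Y.≤-antisym (⊙-assoc-≤ x y z) (subst₂ Y._≤_ (reverse z y x) (sym (reverse x y z)) (⊙-assoc-≤ z y x))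
    where
    reverse : ∀ x y z → ((x ⊙ y) ⊙ z) ≡ (z ⊙ (y ⊙ x))
    reverse x y z = trans (⊙-comm _ z) (cong (z ⊙_) (⊙-comm x y))

  isCommOrderedMonoid : IsCommOrderedMonoid _<Y_ _⊙_ (f 𝟘) (f 𝟙)
  isCommOrderedMonoid = record
    { ordered = orderedY
    ; commMonoid = isCommutativeMonoidʳ record
      { isSemigroup = record
        { isMagma = record { isEquivalence = isEquivalence ; ∙-cong = cong₂ _⊙_ }
        ; assoc = ⊙-assoc
        }
      ; identityʳ = ⊙-identityʳ
      ; comm = ⊙-comm
      }
    ; pos = ⊙-pos
    }

theorem17 : {M Y : Set} (_<M_ : M → M → Set) (_·_ : M → M → M) (𝟘 𝟙 : M)
    → IsCommOrderedMonoid _<M_ _·_ 𝟘 𝟙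
    → LocallyBounded _<M_ _·_ 𝟘
    → Le _<M_ 𝟘 𝟙
    → ContinuousMul _<M_ _·_ 𝟘
    → Preadmissible _<M_ _·_ 𝟘
    → (_<Y_ : Y → Y → Set) (f : M → Y)
    → IsCompletion _<M_ _<Y_ f
    → ConditionStar _<M_ _·_ _<Y_ f
    → (_⊙_ : Y → Y → Y)
    → (∀ x y → IsSup _<Y_ (P _<M_ _·_ _<Y_ f x y) (x ⊙ y))
    → IsCommOrderedMonoid _<Y_ _⊙_ (f 𝟘) (f 𝟙)
theorem17 _ _ _ _ isMonoid locallyBounded 0≤1 cont preadmissible _ _ completion star _ ⊙-sup =
  CompletionProduct.isCommOrderedMonoid
    isMonoid locallyBounded 0≤1 cont preadmissible completion star ⊙-sup
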